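{- Let $G$ be a closed subgroup of $\Omega_\infty$ such that $\phi_i(G)\neq\{0\}$ for every $i\ge0$. Then for all $i,N\ge0$, $$I_G^i\cdot\mathbb{F}_2^{L_N}=I_{\Omega_N}^i\cdot\mathbb{F}_2^{L_N}.$$
   Context: $T_\infty$: Cayley graph of the free monoid on $\{x,y\}$ (word $w$ joined to $xw,yw$), $L_N$ = words of length $N$, $\Omega_\infty$ its profinite automorphism group, $\Omega_N$ its image in the automorphism group of $\bigcup_{i\le N}L_i$. For a word $w$, $\sigma_w$ is the involution fixing words not ending in $w$ and sending $v'w\mapsto\overline{v'}w$ ($x,y$ swapped in $v'$); each $\sigma$ is uniquely $\lim_N\sigma_N\cdots\sigma_0$ with $\sigma_i=\prod_{w\in L_i}\sigma_w^{\varepsilon_w(\sigma)}$, and $\phi_i(\sigma)=\sum_{w\in L_i}\varepsilon_w(\sigma)\in\mathbb{F}_2$ (continuous homomorphisms). $\mathbb{F}_2^{L_N}$ is the permutation module with basis $L_N$; a subgroup $G\le\Omega_\infty$ acts on it through $\Omega_\infty\to\Omega_N$, and $I_G$ (resp. $I_{\Omega_N}$) denotes the augmentation ideal of $\mathbb{F}_2[G]$ (resp. $\mathbb{F}_2[\Omega_N]$). -}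

module Defs where

open import Data.Bool using (Bool; true; false; not; _∧_; _xor_; if_then_else_)
open import Data.Nat using (ℕ; zero; suc; _∸_; _≤ᵇ_; _<_)
open import Data.List using (List; []; _∷_; _++_; map; foldr; length; take; drop)
open import Data.List.Properties using (≡-dec)
open import Data.List.Relation.Unary.All using (All)
open import Data.Product using (Σ; _×_; _,_; ∃)
open import Relation.Binary.PropositionalEquality using (_≡_)
open import Relation.Nullary.Decidable using (⌊_⌋)
open import Function using (id; _∘_)
import Data.Bool.Properties as BP
open import Data.Unit using (⊤)

-- Words over {x,y}: x = false, y = true.  A word is a list of letters
-- written left-to-right as in the paper (so the children of w are x∷w, y∷w).
Word : Set
Word = List Bool

_==_ : Word → Word → Bool
a == b = ⌊ ≡-dec BP._≟_ a b ⌋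

allWords : ℕ → List Word
allWords zero    = [] ∷ []
allWords (suc n) = map (false ∷_) (allWords n) ++ map (true ∷_) (allWords n)

endsIn : Word → Word → Bool
endsIn u w = (length w ≤ᵇ length u) ∧ (drop (length u ∸ length w) u == w)

sigmaW : Word → Word → Word
sigmaW w u = if endsIn u w then map not (take (length u ∸ length w) u) ++ w else u

-- Ω_∞ : an element σ is given by its (unique) family of exponents ε_w(σ).
Portrait : Set
Portrait = Word → Bool

sigmaLevel : Portrait → ℕ → Word → Word
sigmaLevel ε i = foldr (λ w f → (if ε w then sigmaW w else id) ∘ f) id (allWords i)

sigmaUpTo : Portrait → ℕ → Word → Word
sigmaUpTo ε zero    = sigmaLevel ε zero
sigmaUpTo ε (suc n) = sigmaLevel ε (suc n) ∘ sigmaUpTo ε n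

-- σ = lim_N σ_N ⋯ σ_0 ; on a word u the sequence is constant from
-- N = length u on (σ_i with i ≥ length u fixes u), so we evaluate there.
act : Portrait → Word → Word
act ε u = sigmaUpTo ε (length u) u

phi : ℕ → Portrait → Bool
phi i ε = foldr (λ w b → ε w xor b) false (allWords i)

-- Closed subgroups of Ω_∞ (profinite topology = agreement on finite levels)
record ClosedSubgroup (G : Portrait → Set) : Set where
  field
    one-mem : G (λ _ → false)
    mul-mem : ∀ g h → G g → G h →
              Σ Portrait (λ k → G k × (∀ u → act k u ≡ act g (act h u)))
    inv-mem : ∀ g → G g →
              Σ Portrait (λ k → G k × (∀ u → act k (act g u) ≡ u))
    closed  : ∀ ε → (∀ N → Σ Portrait (λ g → G g × (∀ w → length w < N → ε w ≡ g w))) → G ε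

-- The permutation module F₂^{L_N}: a vector is a function on words; only
-- its values on L_N matter (see _≈[_]_).
Vector : Set
Vector = Word → Bool

zeroV : Vector
zeroV _ = false

_⊕_ : Vector → Vector → Vector
(v ⊕ v') u = v u xor v' u

basis : Word → Vector
basis b u = b == u

_≈[_]_ : Vector → ℕ → Vector → Set
v ≈[ N ] v' = ∀ u → length u ≡ N → v u ≡ v' u

actV : ℕ → Portrait → Vector → Vector
actV N g v = foldr (λ w acc → (if v w then basis (act g w) else zeroV) ⊕ acc) zeroV (allWords N)

-- Elements of F₂[G] as finite formal sums (lists) of group elements;
-- coefficients in F₂, so a list represents Σ of its entries.
GroupRingElt : Set
GroupRingElt = List Portrait

actR : ℕ → GroupRingElt → Vector → Vector
actR N a v = foldr (λ g acc → actV N g v ⊕ acc) zeroV a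

augmentation : GroupRingElt → Bool
augmentation a = foldr (λ _ b → not b) false a

InAugIdeal : (Portrait → Set) → GroupRingElt → Set
InAugIdeal G a = All G a × augmentation a ≡ false

actProd : ℕ → List GroupRingElt → Vector → Vector
actProd N as v = foldr (actR N) v as

sumV : List Vector → Vector
sumV = foldr _⊕_ zeroV

-- v ∈ I_G^i · F₂^{L_N}: v is a finite sum of (a₁⋯a_i)·m with a_j ∈ I_G
-- (I_G^i is additively spanned by such products).
InPowerSubmodule : (Portrait → Set) → ℕ → ℕ → Vector → Set
InPowerSubmodule G i N v =
  Σ (List (List GroupRingElt × Vector)) λ gens →
    All (λ p → length (Data.Product.proj₁ p) ≡ i × All (InAugIdeal G) (Data.Product.proj₁ p)) gens ×
    (v ≈[ N ] sumV (map (λ p → actProd N (Data.Product.proj₁ p) (Data.Product.proj₂ p)) gens))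

-- Ω_N acts through Ω_∞ → Ω_N (surjective); its group ring elements are
-- represented by lists of lifts, i.e. G = everything.
AllOmega : Portrait → Set
AllOmega _ = ⊤

{-# OPTIONS --safe #-}
module Submission where

-- The permutation module F₂^{L_N} is uniserial: it has a unique composition
-- series W₀ ⊃ W₁ ⊃ ⋯ ⊃ W_{2^N} = 0, with one-dimensional layers.  It is built
-- from the Ω-equivariant map F₂^{L_{N+1}} → F₂^{L_N}, v ↦ (w ↦ v(xw) + v(yw)),
-- whose kernel is again a copy of F₂^{L_N}.  Every g − 1 maps W_k into W_{k+1},
-- so I^i·F₂^{L_N} ⊆ W_i for any group.  Conversely, if k + 1 = 2^j·odd and
-- φ_j(g) = 1, then g − 1 maps W_k ∖ W_{k+1} into W_{k+1} ∖ W_{k+2}; at the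
-- critical level j this is the identity Σ_{w ∈ L_j} τ_g(w) = φ_j(g), where τ_g(w)
-- records whether g swaps the two children of w.  Choosing such g_k ∈ G, the
-- vectors (g_k − 1)⋯(g_1 − 1)·e_{x^N} meet every layer, so W_i ⊆ I_G^i·F₂^{L_N}.

open import Defs
open import Data.Bool using (Bool; true; false; not; _∧_; _xor_; if_then_else_; T)
open import Data.Bool.Properties as BP
  using (xor-assoc; xor-comm; xor-identityʳ; xor-same; ∧-identityʳ; ∧-zeroʳ; ∧-distribʳ-xor; not-involutive)
open import Data.Nat using (ℕ; zero; suc; pred; _+_; _∸_; _^_; _≤_; _<_; _≤ᵇ_; _<ᵇ_; _≡ᵇ_; _≤?_; z≤n; s≤s; z<s)
open import Data.Nat.Properties
  using (≤-refl; ≤-trans; ≤-reflexive; ≤-antisym; n≤1+n; n∸n≡0; m∸n≤m; +-∸-assoc; m∸n+n≡m; m≤n⇒m⊓n≡m; ≤ᵇ⇒≤; ≤⇒≤ᵇ;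
         <ᵇ⇒<; <⇒<ᵇ; <⇒≱; ≰⇒>; m≤m+n; m+n∸m≡n; m+[n∸m]≡n; +-identityʳ; +-suc; +-comm; m^n>0; +-assoc; +-cancelˡ-<; suc-pred; m^n≢0; suc-injective; ≡ᵇ⇒≡; ≡⇒≡ᵇ; m+1+n≢m; m+1+n≰m; <-irrefl; <⇒≤; m<m+n)
open import Data.List using (List; []; _∷_; _++_; map; foldr; length; take; drop; replicate)
open import Data.List.Properties using (≡-dec; length-map; length-++; length-take; map-++; length-replicate; take++drop≡id; foldr-++)
open import Data.List.Relation.Unary.All as All using (All; []; _∷_)
import Data.List.Relation.Unary.All.Properties as All
open import Relation.Binary.PropositionalEquality
open import Data.Product using (Σ; _×_; _,_; proj₁; proj₂)
open import Relation.Nullary using (yes; no)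
open import Relation.Nullary.Decidable using (⌊_⌋)
open import Data.Empty using (⊥-elim)
open import Function using (id; _∘_; _$_)
open import Function.Bundles using (Equivalence; _⇔_; mk⇔)
open import Data.Unit using (tt)
open import Algebra.Bundles using (CommutativeRing)
open import Algebra.Properties.CommutativeSemigroup
  (CommutativeRing.+-commutativeSemigroup BP.xor-∧-commutativeRing) using (interchange)

_=ᵇ_ : Bool → Bool → Bool
a =ᵇ b = ⌊ a BP.≟ b ⌋

==-∷ : ∀ a b (u w : Word) → ((a ∷ u) == (b ∷ w)) ≡ (a =ᵇ b) ∧ (u == w)
==-∷ a b u w with a BP.≟ b | ≡-dec BP._≟_ u w
... | yes refl | yes refl = refl
... | yes refl | no _     = refl
... | no _     | yes _    = refl
... | no _     | no _     = refl

==-refl : ∀ u → (u == u) ≡ true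
==-refl u with ≡-dec BP._≟_ u u
... | yes _  = refl
... | no u≢u = ⊥-elim (u≢u refl)

==⇒≡ : ∀ u w → (u == w) ≡ true → u ≡ w
==⇒≡ u w _  with ≡-dec BP._≟_ u w
==⇒≡ u w _  | yes u≡w = u≡w
==⇒≡ u w () | no _

==-sym : ∀ u w → (u == w) ≡ (w == u)
==-sym u w with ≡-dec BP._≟_ u w | ≡-dec BP._≟_ w u
... | yes _   | yes _   = refl
... | no _    | no _    = refl
... | yes u≡w | no w≢u  = ⊥-elim (w≢u (sym u≡w))
... | no u≢w  | yes w≡u = ⊥-elim (u≢w (sym w≡u))

∧-true-left : ∀ a b → (a ∧ b) ≡ true → a ≡ true
∧-true-left true _ _ = refl

∧-true-right : ∀ a b → (a ∧ b) ≡ true → b ≡ true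
∧-true-right true _ b≡true = b≡true

xor-cancel-middle : ∀ a u c → (a xor u) xor (u xor c) ≡ a xor c
xor-cancel-middle a u c = begin
  (a xor u) xor (u xor c)   ≡⟨ xor-assoc a u (u xor c) ⟩
  a xor (u xor (u xor c))   ≡⟨ cong (a xor_) (xor-assoc u u c) ⟨
  a xor ((u xor u) xor c)   ≡⟨ cong (λ b → a xor (b xor c)) (xor-same u) ⟩
  a xor c                   ∎
  where open ≡-Reasoning

-- Xor-sums over the levels L_N

xorSum : List Word → (Word → Bool) → Bool
xorSum ws f = foldr (λ w b → f w xor b) false ws

levelSum : ℕ → (Word → Bool) → Bool
levelSum N = xorSum (allWords N)

xorSum-++ : ∀ us ws f → xorSum (us ++ ws) f ≡ xorSum us f xor xorSum ws f
xorSum-++ []       ws f = refl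
xorSum-++ (u ∷ us) ws f rewrite xorSum-++ us ws f = sym (xor-assoc (f u) (xorSum us f) (xorSum ws f))

xorSum-map : ∀ (g : Word → Word) ws f → xorSum (map g ws) f ≡ xorSum ws (f ∘ g)
xorSum-map g []       f = refl
xorSum-map g (w ∷ ws) f = cong (f (g w) xor_) (xorSum-map g ws f)

xorSum-cong : ∀ {P : Word → Set} ws f h → All P ws → (∀ w → P w → f w ≡ h w) → xorSum ws f ≡ xorSum ws h
xorSum-cong []       f h []       _    = refl
xorSum-cong (w ∷ ws) f h (p ∷ ps) f≗h = cong₂ _xor_ (f≗h w p) (xorSum-cong ws f h ps f≗h)

xorSum-false : ∀ ws → xorSum ws (λ _ → false) ≡ false
xorSum-false []       = refl
xorSum-false (_ ∷ ws) = xorSum-false ws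

xorSum-xor : ∀ ws f h → xorSum ws f xor xorSum ws h ≡ xorSum ws (λ w → f w xor h w)
xorSum-xor []       f h = refl
xorSum-xor (w ∷ ws) f h =
  trans (interchange (f w) (xorSum ws f) (h w) (xorSum ws h)) (cong ((f w xor h w) xor_) (xorSum-xor ws f h))

xorSum-∧ : ∀ ws b f → xorSum ws (λ w → b ∧ f w) ≡ b ∧ xorSum ws f
xorSum-∧ ws false f = xorSum-false ws
xorSum-∧ ws true  f = refl

xorSum-comm : ∀ us ws (F : Word → Word → Bool) →
              xorSum us (λ u → xorSum ws (F u)) ≡ xorSum ws (λ w → xorSum us (λ u → F u w))
xorSum-comm []       ws F = sym (xorSum-false ws)
xorSum-comm (u ∷ us) ws F =
  trans (cong (xorSum ws (F u) xor_) (xorSum-comm us ws F)) (xorSum-xor ws (F u) _)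

allWords-length : ∀ n → All (λ w → length w ≡ n) (allWords n)
allWords-length zero    = refl ∷ []
allWords-length (suc n) = All.++⁺ (prepend false) (prepend true)
  where
  prepend : ∀ c → All (λ w → length w ≡ suc n) (map (c ∷_) (allWords n))
  prepend c = All.map⁺ (All.map (cong suc) (allWords-length n))

levelSum-suc : ∀ N f → levelSum (suc N) f ≡ levelSum N (f ∘ (false ∷_)) xor levelSum N (f ∘ (true ∷_))
levelSum-suc N f =
  trans (xorSum-++ (map (false ∷_) (allWords N)) _ f)
        (cong₂ _xor_ (xorSum-map (false ∷_) (allWords N) f) (xorSum-map (true ∷_) (allWords N) f))

levelSum-cong : ∀ N f h → (∀ w → length w ≡ N → f w ≡ h w) → levelSum N f ≡ levelSum N h
levelSum-cong N f h = xorSum-cong (allWords N) f h (allWords-length N)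

levelSum-indicator : ∀ N (f : Word → Bool) u → length u ≡ N → levelSum N (λ w → f w ∧ (w == u)) ≡ f u
levelSum-indicator zero f [] refl rewrite ∧-identityʳ (f []) | ==-refl [] = xor-identityʳ (f [])
levelSum-indicator (suc N) f (c ∷ u) refl = begin
  levelSum (suc N) (λ w → f w ∧ (w == (c ∷ u)))
    ≡⟨ levelSum-suc N (λ w → f w ∧ (w == (c ∷ u))) ⟩
  levelSum N (λ w → f (false ∷ w) ∧ ((false ∷ w) == (c ∷ u)))
    xor levelSum N (λ w → f (true ∷ w) ∧ ((true ∷ w) == (c ∷ u)))
    ≡⟨ cong₂ _xor_ (levelSum-cong N _ _ (λ w _ → separate false w)) (levelSum-cong N _ _ (λ w _ → separate true w)) ⟩
  levelSum N (λ w → ((false =ᵇ c) ∧ f (false ∷ w)) ∧ (w == u))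
    xor levelSum N (λ w → ((true =ᵇ c) ∧ f (true ∷ w)) ∧ (w == u))
    ≡⟨ cong₂ _xor_ (levelSum-indicator N (λ w → (false =ᵇ c) ∧ f (false ∷ w)) u refl)
                   (levelSum-indicator N (λ w → (true =ᵇ c) ∧ f (true ∷ w)) u refl) ⟩
  ((false =ᵇ c) ∧ f (false ∷ u)) xor ((true =ᵇ c) ∧ f (true ∷ u))
    ≡⟨ select c ⟩
  f (c ∷ u) ∎
  where
  open ≡-Reasoning
  separate : ∀ d w → (f (d ∷ w) ∧ ((d ∷ w) == (c ∷ u))) ≡ ((d =ᵇ c) ∧ f (d ∷ w)) ∧ (w == u)
  separate d w rewrite ==-∷ d c w u with d =ᵇ c | f (d ∷ w)
  ... | false | false = refl
  ... | false | true  = refl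
  ... | true  | _     = refl
  select : ∀ c → ((false =ᵇ c) ∧ f (false ∷ u)) xor ((true =ᵇ c) ∧ f (true ∷ u)) ≡ f (c ∷ u)
  select false = xor-identityʳ _
  select true  = refl

-- The involutions σ_w

drop-length-++ : ∀ {A : Set} (xs ys : List A) → drop (length xs) (xs ++ ys) ≡ ys
drop-length-++ []       ys = refl
drop-length-++ (_ ∷ xs) ys = drop-length-++ xs ys

length-take-≤ : ∀ {A : Set} k (xs : List A) → k ≤ length xs → length (take k xs) ≡ k
length-take-≤ k xs k≤ = trans (length-take k xs) (m≤n⇒m⊓n≡m k≤)

≤⇒≤ᵇ≡true : ∀ {m n} → m ≤ n → (m ≤ᵇ n) ≡ true
≤⇒≤ᵇ≡true = Equivalence.to BP.T-≡ ∘ ≤⇒≤ᵇ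

≤ᵇ≡true⇒≤ : ∀ {m n} → (m ≤ᵇ n) ≡ true → m ≤ n
≤ᵇ≡true⇒≤ = ≤ᵇ⇒≤ _ _ ∘ Equivalence.from BP.T-≡

flippedPrefix : Word → Word → Word
flippedPrefix w' u = map not (take (length u ∸ length w') u)

length-flippedPrefix : ∀ w' u → length (flippedPrefix w' u) ≡ length u ∸ length w'
length-flippedPrefix w' u =
  trans (length-map not (take (length u ∸ length w') u)) (length-take-≤ _ u (m∸n≤m (length u) (length w')))

endsIn-∷ : ∀ c w w' → length w' ≤ length w → endsIn (c ∷ w) w' ≡ endsIn w w'
endsIn-∷ c w w' w'≤w
  rewrite +-∸-assoc 1 w'≤w | ≤⇒≤ᵇ≡true w'≤w | ≤⇒≤ᵇ≡true (≤-trans w'≤w (n≤1+n _)) = refl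

endsIn-sameLength : ∀ u w' → length w' ≡ length u → endsIn u w' ≡ (u == w')
endsIn-sameLength u w' e rewrite e | n∸n≡0 (length u) | ≤⇒≤ᵇ≡true (≤-refl {length u}) = refl

endsIn⇒≤ : ∀ u w' → endsIn u w' ≡ true → length w' ≤ length u
endsIn⇒≤ u w' e = ≤ᵇ≡true⇒≤ (∧-true-left _ _ e)

endsIn⇒drop : ∀ u w' → endsIn u w' ≡ true → drop (length u ∸ length w') u ≡ w'
endsIn⇒drop u w' e = ==⇒≡ _ _ (∧-true-right _ _ e)

sigmaW-∷ : ∀ c w w' → length w' ≤ length w → sigmaW w' (c ∷ w) ≡ (c xor endsIn w w') ∷ sigmaW w' w
sigmaW-∷ c w w' w'≤w rewrite endsIn-∷ c w w' w'≤w | +-∸-assoc 1 w'≤w with endsIn w w'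
... | true  = cong (_∷ _) (sym (xor-comm c true))
... | false = cong (_∷ w) (sym (xor-identityʳ c))

length-sigmaW : ∀ w' u → length (sigmaW w' u) ≡ length u
length-sigmaW w' u with endsIn u w' in e
... | false = refl
... | true  = begin
  length (flippedPrefix w' u ++ w')              ≡⟨ length-++ (flippedPrefix w' u) ⟩
  length (flippedPrefix w' u) + length w'        ≡⟨ cong (_+ length w') (length-flippedPrefix w' u) ⟩
  (length u ∸ length w') + length w'             ≡⟨ m∸n+n≡m (endsIn⇒≤ u w' e) ⟩
  length u                                       ∎
  where open ≡-Reasoning

drop-sigmaW : ∀ w' u → drop (length u ∸ length w') (sigmaW w' u) ≡ drop (length u ∸ length w') u
drop-sigmaW w' u with endsIn u w' in e
... | false = refl
... | true  = begin
  drop (length u ∸ length w') (flippedPrefix w' u ++ w')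
    ≡⟨ cong (λ k → drop k (flippedPrefix w' u ++ w')) (length-flippedPrefix w' u) ⟨
  drop (length (flippedPrefix w' u)) (flippedPrefix w' u ++ w')
    ≡⟨ drop-length-++ (flippedPrefix w' u) w' ⟩
  w'
    ≡⟨ endsIn⇒drop u w' e ⟨
  drop (length u ∸ length w') u ∎
  where open ≡-Reasoning

sigmaW-short : ∀ w' u → length u ≤ length w' → sigmaW w' u ≡ u
sigmaW-short w' u u≤w' with endsIn u w' in e
... | false = refl
... | true  = begin
  flippedPrefix w' u ++ w'                      ≡⟨ cong (λ k → map not (take k u) ++ w') nothing-flipped ⟩
  w'                                            ≡⟨ endsIn⇒drop u w' e ⟨
  drop (length u ∸ length w') u                 ≡⟨ cong (λ k → drop k u) nothing-flipped ⟩
  u                                             ∎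
  where
  open ≡-Reasoning
  nothing-flipped : length u ∸ length w' ≡ 0
  nothing-flipped rewrite ≤-antisym u≤w' (endsIn⇒≤ u w' e) = n∸n≡0 (length w')

-- The action of a portrait on words

OfLength : ℕ → List Word → Set
OfLength n = All (λ w → length w ≡ n)

module _ (ε : Portrait) where

  σ : Word → Word → Word
  σ w = if ε w then sigmaW w else id

  applyAll : List Word → Word → Word
  applyAll ws = foldr (λ w f → σ w ∘ f) id ws

  headFlips : List Word → Word → Bool
  headFlips ws w = xorSum ws (λ w' → ε w' ∧ endsIn w w')

  length-σ : ∀ w u → length (σ w u) ≡ length u
  length-σ w u with ε w
  ... | true  = length-sigmaW w u
  ... | false = refl

  length-applyAll : ∀ ws u → length (applyAll ws u) ≡ length u
  length-applyAll []       u = refl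
  length-applyAll (w ∷ ws) u = trans (length-σ w (applyAll ws u)) (length-applyAll ws u)

  applyAll-short : ∀ ws u → All (λ w' → length u ≤ length w') ws → applyAll ws u ≡ u
  applyAll-short []       u _        = refl
  applyAll-short (w ∷ ws) u (p ∷ ps) rewrite applyAll-short ws u ps with ε w
  ... | true  = sigmaW-short w u p
  ... | false = refl

  drop-applyAll : ∀ n ws u → OfLength n ws → drop (length u ∸ n) (applyAll ws u) ≡ drop (length u ∸ n) u
  drop-applyAll n []       u _        = refl
  drop-applyAll n (w ∷ ws) u (refl ∷ ps) = trans drop-σ (drop-applyAll n ws u ps)
    where
    drop-σ : drop (length u ∸ length w) (σ w (applyAll ws u)) ≡ drop (length u ∸ length w) (applyAll ws u)
    drop-σ with ε w
    ... | false = refl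
    ... | true  = subst (λ l → drop (l ∸ length w) (sigmaW w (applyAll ws u)) ≡ drop (l ∸ length w) (applyAll ws u))
                        (length-applyAll ws u) (drop-sigmaW w (applyAll ws u))

  endsIn-applyAll : ∀ ws u w' → OfLength (length w') ws → endsIn (applyAll ws u) w' ≡ endsIn u w'
  endsIn-applyAll ws u w' ps rewrite length-applyAll ws u | drop-applyAll (length w') ws u ps = refl

  applyAll-∷ : ∀ n ws c w → OfLength n ws → n ≤ length w →
               applyAll ws (c ∷ w) ≡ (c xor headFlips ws w) ∷ applyAll ws w
  applyAll-∷ n []        c w _           n≤w = cong (_∷ w) (sym (xor-identityʳ c))
  applyAll-∷ n (w' ∷ ws) c w (refl ∷ ps) n≤w rewrite applyAll-∷ n ws c w ps n≤w with ε w'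
  ... | false = refl
  ... | true  = trans (sigmaW-∷ (c xor headFlips ws w) (applyAll ws w) w' (subst (n ≤_) (sym (length-applyAll ws w)) n≤w))
                      (cong (_∷ _) (begin
      (c xor headFlips ws w) xor endsIn (applyAll ws w) w' ≡⟨ cong ((c xor headFlips ws w) xor_) (endsIn-applyAll ws w w' ps) ⟩
      (c xor headFlips ws w) xor endsIn w w'               ≡⟨ xor-assoc c _ _ ⟩
      c xor (headFlips ws w xor endsIn w w')               ≡⟨ cong (c xor_) (xor-comm (headFlips ws w) (endsIn w w')) ⟩
      c xor (endsIn w w' xor headFlips ws w)               ∎))
    where open ≡-Reasoning

  headFlips-∷ : ∀ n ws d w → OfLength n ws → n ≤ length w → headFlips ws (d ∷ w) ≡ headFlips ws w
  headFlips-∷ n ws d w ps n≤w =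
    xorSum-cong ws _ _ ps (λ w' p → cong (ε w' ∧_) (endsIn-∷ d w w' (subst (_≤ length w) (sym p) n≤w)))

  headFlips-self : ∀ u → headFlips (allWords (length u)) u ≡ ε u
  headFlips-self u =
    trans (levelSum-cong (length u) _ (λ w' → ε w' ∧ (w' == u))
                         (λ w' p → cong (ε w' ∧_) (trans (endsIn-sameLength u w' p) (==-sym u w'))))
          (levelSum-indicator (length u) ε u refl)

  sigmaLevel-∷ : ∀ n c w → n ≤ length w →
                 sigmaLevel ε n (c ∷ w) ≡ (c xor headFlips (allWords n) w) ∷ sigmaLevel ε n w
  sigmaLevel-∷ n c w = applyAll-∷ n (allWords n) c w (allWords-length n)

  sigmaLevel-short : ∀ n u → length u ≤ n → sigmaLevel ε n u ≡ u
  sigmaLevel-short n u u≤n =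
    applyAll-short (allWords n) u (All.map (λ p → subst (length u ≤_) (sym p) u≤n) (allWords-length n))

  length-sigmaUpTo : ∀ n u → length (sigmaUpTo ε n u) ≡ length u
  length-sigmaUpTo zero    u = length-applyAll (allWords zero) u
  length-sigmaUpTo (suc n) u = trans (length-applyAll (allWords (suc n)) _) (length-sigmaUpTo n u)

  upToFlips : ℕ → Word → Bool
  upToFlips zero    w = headFlips (allWords zero) w
  upToFlips (suc n) w = upToFlips n w xor headFlips (allWords (suc n)) (sigmaUpTo ε n w)

  sigmaUpTo-∷ : ∀ n c w → n ≤ length w → sigmaUpTo ε n (c ∷ w) ≡ (c xor upToFlips n w) ∷ sigmaUpTo ε n w
  sigmaUpTo-∷ zero    c w _   = sigmaLevel-∷ zero c w z≤n
  sigmaUpTo-∷ (suc n) c w n<w =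
    trans (cong (sigmaLevel ε (suc n)) (sigmaUpTo-∷ n c w (≤-trans (n≤1+n n) n<w)))
          (trans (sigmaLevel-∷ (suc n) (c xor upToFlips n w) (sigmaUpTo ε n w)
                               (subst (suc n ≤_) (sym (length-sigmaUpTo n w)) n<w))
                 (cong (_∷ _) (xor-assoc c (upToFlips n w) _)))

  upToFlips-∷ : ∀ n d w → n ≤ length w → upToFlips n (d ∷ w) ≡ upToFlips n w
  upToFlips-∷ zero    d w _   = headFlips-∷ zero (allWords zero) d w (allWords-length zero) z≤n
  upToFlips-∷ (suc n) d w n<w =
    cong₂ _xor_ (upToFlips-∷ n d w (≤-trans (n≤1+n n) n<w))
      (trans (cong (headFlips (allWords (suc n))) (sigmaUpTo-∷ n d w (≤-trans (n≤1+n n) n<w)))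
             (headFlips-∷ (suc n) (allWords (suc n)) _ _ (allWords-length (suc n))
                          (subst (suc n ≤_) (sym (length-sigmaUpTo n w)) n<w)))

  flipAt : Word → Bool
  flipAt w = upToFlips (length w) w

  act-∷ : ∀ c w → act ε (c ∷ w) ≡ (c xor flipAt w) ∷ act ε w
  act-∷ c w =
    trans (sigmaLevel-short (suc (length w)) (sigmaUpTo ε (length w) (c ∷ w))
                            (≤-reflexive (length-sigmaUpTo (length w) (c ∷ w))))
          (sigmaUpTo-∷ (length w) c w ≤-refl)

  act-[] : act ε [] ≡ []
  act-[] = sigmaLevel-short zero [] z≤n

  length-act : ∀ u → length (act ε u) ≡ length u
  length-act u = length-sigmaUpTo (length u) u

  flipAt-∷ : ∀ d w → flipAt (d ∷ w) ≡ flipAt w xor ε (act ε (d ∷ w))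
  flipAt-∷ d w = cong₂ _xor_ (upToFlips-∷ (length w) d w ≤-refl) (begin
    headFlips (allWords (suc (length w))) u
      ≡⟨ cong (λ k → headFlips (allWords k) u) (sym (length-sigmaUpTo (length w) (d ∷ w))) ⟩
    headFlips (allWords (length u)) u
      ≡⟨ headFlips-self u ⟩
    ε u
      ≡⟨ cong ε (sigmaLevel-short (suc (length w)) u (≤-reflexive (length-sigmaUpTo (length w) (d ∷ w)))) ⟨
    ε (act ε (d ∷ w)) ∎)
    where
    open ≡-Reasoning
    u : Word
    u = sigmaUpTo ε (length w) (d ∷ w)

  flipAt-[] : flipAt [] ≡ ε []
  flipAt-[] = headFlips-self []

identityPortrait : Portrait
identityPortrait _ = false

act-identity : ∀ u → act identityPortrait u ≡ u
act-identity u = sigmaUpTo-identity (length u) u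
  where
  applyAll-identity : ∀ ws u → applyAll identityPortrait ws u ≡ u
  applyAll-identity []       u = refl
  applyAll-identity (_ ∷ ws) u = applyAll-identity ws u
  sigmaUpTo-identity : ∀ n u → sigmaUpTo identityPortrait n u ≡ u
  sigmaUpTo-identity zero    u = applyAll-identity (allWords zero) u
  sigmaUpTo-identity (suc n) u = trans (applyAll-identity (allWords (suc n)) _) (sigmaUpTo-identity n u)

-- The permutation modules F₂^{L_N}

actV-apply : ∀ N g v u → actV N g v u ≡ levelSum N (λ w → v w ∧ (act g w == u))
actV-apply N g v u = go (allWords N)
  where
  go : ∀ ws → foldr (λ w acc → (if v w then basis (act g w) else zeroV) ⊕ acc) zeroV ws u
              ≡ xorSum ws (λ w → v w ∧ (act g w == u))
  go []       = refl
  go (w ∷ ws) with v w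
  ... | true  = cong ((act g w == u) xor_) (go ws)
  ... | false = go ws

sumChildren : Vector → Vector
sumChildren v w = v (false ∷ w) xor v (true ∷ w)

xChild yChild : Vector → Vector
xChild v w = v (false ∷ w)
yChild v w = v (true ∷ w)

select-∧ : ∀ (f : Bool → Bool) t c b →
           (f false ∧ ((t =ᵇ c) ∧ b)) xor (f true ∧ ((not t =ᵇ c) ∧ b)) ≡ f (c xor t) ∧ b
select-∧ f false false b rewrite ∧-zeroʳ (f true)  = xor-identityʳ _
select-∧ f false true  b rewrite ∧-zeroʳ (f false) = refl
select-∧ f true  false b rewrite ∧-zeroʳ (f false) = refl
select-∧ f true  true  b rewrite ∧-zeroʳ (f true)  = xor-identityʳ _

actV-∷ : ∀ N g v c u → actV (suc N) g v (c ∷ u) ≡ levelSum N (λ w → v ((c xor flipAt g w) ∷ w) ∧ (act g w == u))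
actV-∷ N g v c u = begin
  actV (suc N) g v (c ∷ u)
    ≡⟨ actV-apply (suc N) g v (c ∷ u) ⟩
  levelSum (suc N) (λ w → v w ∧ (act g w == (c ∷ u)))
    ≡⟨ levelSum-suc N (λ w → v w ∧ (act g w == (c ∷ u))) ⟩
  levelSum N (term false) xor levelSum N (term true)
    ≡⟨ cong₂ _xor_ (levelSum-cong N (term false) (split false) (λ w _ → term≡split false w))
                   (levelSum-cong N (term true) (split true) (λ w _ → term≡split true w)) ⟩
  levelSum N (split false) xor levelSum N (split true)
    ≡⟨ xorSum-xor (allWords N) (split false) (split true) ⟩
  levelSum N (λ w → split false w xor split true w)
    ≡⟨ levelSum-cong N _ _ (λ w _ → select-∧ (λ d → v (d ∷ w)) (flipAt g w) c (act g w == u)) ⟩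
  levelSum N (λ w → v ((c xor flipAt g w) ∷ w) ∧ (act g w == u)) ∎
  where
  open ≡-Reasoning
  term split : Bool → Word → Bool
  term d w  = v (d ∷ w) ∧ (act g (d ∷ w) == (c ∷ u))
  split d w = v (d ∷ w) ∧ (((d xor flipAt g w) =ᵇ c) ∧ (act g w == u))
  term≡split : ∀ d w → term d w ≡ split d w
  term≡split d w = cong (v (d ∷ w) ∧_) (trans (cong (_== (c ∷ u)) (act-∷ g d w)) (==-∷ _ c _ u))

sumChildren-actV : ∀ N g v w → sumChildren (actV (suc N) g v) w ≡ actV N g (sumChildren v) w
sumChildren-actV N g v u = begin
  actV (suc N) g v (false ∷ u) xor actV (suc N) g v (true ∷ u)
    ≡⟨ cong₂ _xor_ (actV-∷ N g v false u) (actV-∷ N g v true u) ⟩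
  levelSum N (term false) xor levelSum N (term true)
    ≡⟨ xorSum-xor (allWords N) (term false) (term true) ⟩
  levelSum N (λ w → term false w xor term true w)
    ≡⟨ levelSum-cong N _ _ (λ w _ → both-children (λ d → v (d ∷ w)) (flipAt g w) (act g w == u)) ⟩
  levelSum N (λ w → sumChildren v w ∧ (act g w == u))
    ≡⟨ actV-apply N g (sumChildren v) u ⟨
  actV N g (sumChildren v) u ∎
  where
  open ≡-Reasoning
  term : Bool → Word → Bool
  term c w = v ((c xor flipAt g w) ∷ w) ∧ (act g w == u)
  both-children : ∀ (f : Bool → Bool) t b → (f t ∧ b) xor (f (not t) ∧ b) ≡ (f false xor f true) ∧ b
  both-children f false b = sym (∧-distribʳ-xor b (f false) (f true))
  both-children f true  b = trans (xor-comm (f true ∧ b) (f false ∧ b)) (sym (∧-distribʳ-xor b (f false) (f true)))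

actV-cong : ∀ N g v v' → v ≈[ N ] v' → ∀ u → actV N g v u ≡ actV N g v' u
actV-cong N g v v' v≈v' u = begin
  actV N g v u                                ≡⟨ actV-apply N g v u ⟩
  levelSum N (λ w → v w ∧ (act g w == u))     ≡⟨ levelSum-cong N _ _ (λ w ∣w∣ → cong (_∧ (act g w == u)) (v≈v' w ∣w∣)) ⟩
  levelSum N (λ w → v' w ∧ (act g w == u))    ≡⟨ actV-apply N g v' u ⟨
  actV N g v' u                               ∎
  where open ≡-Reasoning

actV-zeroV : ∀ N g u → actV N g zeroV u ≡ false
actV-zeroV N g u = trans (actV-apply N g zeroV u) (xorSum-false (allWords N))

actV-xChild : ∀ N g v c u → sumChildren v ≈[ N ] zeroV → actV (suc N) g v (c ∷ u) ≡ actV N g (xChild v) u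
actV-xChild N g v c u children-agree = begin
  actV (suc N) g v (c ∷ u)                                  ≡⟨ actV-∷ N g v c u ⟩
  levelSum N (λ w → v ((c xor flipAt g w) ∷ w) ∧ (act g w == u))
    ≡⟨ levelSum-cong N _ _ (λ w ∣w∣ → cong (_∧ (act g w == u))
                                           (same-children (λ d → v (d ∷ w)) (c xor flipAt g w) (children-agree w ∣w∣))) ⟩
  levelSum N (λ w → xChild v w ∧ (act g w == u))            ≡⟨ actV-apply N g (xChild v) u ⟨
  actV N g (xChild v) u                                     ∎
  where
  open ≡-Reasoning
  same-children : ∀ (f : Bool → Bool) b → f false xor f true ≡ false → f b ≡ f false
  same-children f false _ = refl
  same-children f true  e with f false | f true
  ... | false | false = refl
  ... | true  | true  = refl

actV-identity : ∀ N v u → length u ≡ N → actV N identityPortrait v u ≡ v u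
actV-identity N v u ∣u∣ = begin
  actV N identityPortrait v u
    ≡⟨ actV-apply N identityPortrait v u ⟩
  levelSum N (λ w → v w ∧ (act identityPortrait w == u))
    ≡⟨ levelSum-cong N _ _ (λ w _ → cong (λ w' → v w ∧ (w' == u)) (act-identity w)) ⟩
  levelSum N (λ w → v w ∧ (w == u))
    ≡⟨ levelSum-indicator N v u ∣u∣ ⟩
  v u ∎
  where open ≡-Reasoning

actV-[] : ∀ g v → actV zero g v [] ≡ v []
actV-[] g v rewrite actV-apply zero g v [] | act-[] g | ∧-identityʳ (v []) = xor-identityʳ (v [])

levelSum-act : ∀ N g f → levelSum N (f ∘ act g) ≡ levelSum N f
levelSum-act zero    g f = cong (_xor false) (cong f (act-[] g))
levelSum-act (suc N) g f = begin
  levelSum (suc N) (f ∘ act g)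
    ≡⟨ levelSum-suc N (f ∘ act g) ⟩
  levelSum N (f ∘ act g ∘ (false ∷_)) xor levelSum N (f ∘ act g ∘ (true ∷_))
    ≡⟨ cong₂ _xor_ (levelSum-cong N _ _ (λ w _ → cong f (act-∷ g false w)))
                   (levelSum-cong N _ _ (λ w _ → cong f (act-∷ g true w))) ⟩
  levelSum N (λ w → f (flipAt g w ∷ act g w)) xor levelSum N (λ w → f (not (flipAt g w) ∷ act g w))
    ≡⟨ xorSum-xor (allWords N) (λ w → f (flipAt g w ∷ act g w)) (λ w → f (not (flipAt g w) ∷ act g w)) ⟩
  levelSum N (λ w → f (flipAt g w ∷ act g w) xor f (not (flipAt g w) ∷ act g w))
    ≡⟨ levelSum-cong N _ _ (λ w _ → both-children (flipAt g w) (act g w)) ⟩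
  levelSum N (sumChildren f ∘ act g)
    ≡⟨ levelSum-act N g (sumChildren f) ⟩
  levelSum N (sumChildren f)
    ≡⟨ xorSum-xor (allWords N) (xChild f) (yChild f) ⟨
  levelSum N (f ∘ (false ∷_)) xor levelSum N (f ∘ (true ∷_))
    ≡⟨ levelSum-suc N f ⟨
  levelSum (suc N) f ∎
  where
  open ≡-Reasoning
  both-children : ∀ t w → f (t ∷ w) xor f (not t ∷ w) ≡ sumChildren f w
  both-children false w = refl
  both-children true  w = xor-comm (f (true ∷ w)) (f (false ∷ w))

-- No induction: summing flipAt-∷ over both children cancels the two copies of
-- flipAt g w, and act g permutes L_{N+1}.
levelSum-flipAt : ∀ N g → levelSum N (flipAt g) ≡ phi N g
levelSum-flipAt zero    g = cong (_xor false) (flipAt-[] g)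
levelSum-flipAt (suc N) g = begin
  levelSum (suc N) (flipAt g)
    ≡⟨ levelSum-suc N (flipAt g) ⟩
  levelSum N (flipAt g ∘ (false ∷_)) xor levelSum N (flipAt g ∘ (true ∷_))
    ≡⟨ cong₂ _xor_ (unfold false) (unfold true) ⟩
  (levelSum N (flipAt g) xor levelSum N (g ∘ act g ∘ (false ∷_)))
    xor (levelSum N (flipAt g) xor levelSum N (g ∘ act g ∘ (true ∷_)))
    ≡⟨ interchange (levelSum N (flipAt g)) _ (levelSum N (flipAt g)) _ ⟩
  (levelSum N (flipAt g) xor levelSum N (flipAt g))
    xor (levelSum N (g ∘ act g ∘ (false ∷_)) xor levelSum N (g ∘ act g ∘ (true ∷_)))
    ≡⟨ cong (_xor (levelSum N (g ∘ act g ∘ (false ∷_)) xor levelSum N (g ∘ act g ∘ (true ∷_))))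
            (xor-same (levelSum N (flipAt g))) ⟩
  levelSum N (g ∘ act g ∘ (false ∷_)) xor levelSum N (g ∘ act g ∘ (true ∷_))
    ≡⟨ levelSum-suc N (g ∘ act g) ⟨
  levelSum (suc N) (g ∘ act g)
    ≡⟨ levelSum-act (suc N) g g ⟩
  phi (suc N) g ∎
  where
  open ≡-Reasoning
  unfold : ∀ d → levelSum N (flipAt g ∘ (d ∷_)) ≡ levelSum N (flipAt g) xor levelSum N (g ∘ act g ∘ (d ∷_))
  unfold d = trans (levelSum-cong N _ _ (λ w _ → flipAt-∷ g d w))
                   (sym (xorSum-xor (allWords N) (flipAt g) (g ∘ act g ∘ (d ∷_))))

actMinusOne : ℕ → Portrait → Vector → Vector
actMinusOne N g v = actV N g v ⊕ v

onesV : Vector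
onesV _ = true

levelSum-== : ∀ N a → length a ≡ N → levelSum N (a ==_) ≡ true
levelSum-== N a ∣a∣ = trans (levelSum-cong N _ (λ w → true ∧ (w == a)) (λ w _ → ==-sym a w))
                            (levelSum-indicator N (λ _ → true) a ∣a∣)

levelSum-xChild-actV : ∀ N g v → levelSum N (xChild (actV (suc N) g v)) ≡ levelSum N (λ w → v (flipAt g w ∷ w))
levelSum-xChild-actV N g v = begin
  levelSum N (xChild (actV (suc N) g v))
    ≡⟨ levelSum-cong N _ _ (λ u _ → actV-∷ N g v false u) ⟩
  levelSum N (λ u → levelSum N (λ w → image w ∧ (act g w == u)))
    ≡⟨ xorSum-comm (allWords N) (allWords N) (λ w u → image w ∧ (act g w == u)) ⟨
  levelSum N (λ w → levelSum N (λ u → image w ∧ (act g w == u)))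
    ≡⟨ levelSum-cong N _ _ (λ w ∣w∣ → trans (xorSum-∧ (allWords N) (image w) (act g w ==_))
                                           (trans (cong (image w ∧_) (levelSum-== N (act g w) (trans (length-act g w) ∣w∣)))
                                                  (∧-identityʳ _))) ⟩
  levelSum N image ∎
  where
  open ≡-Reasoning
  image : Word → Bool
  image w = v (flipAt g w ∷ w)

levelSum-xChild-actMinusOne : ∀ N g v → sumChildren v ≈[ N ] onesV →
                              levelSum N (xChild (actMinusOne (suc N) g v)) ≡ phi N g
levelSum-xChild-actMinusOne N g v children-differ = begin
  levelSum N (xChild (actMinusOne (suc N) g v))
    ≡⟨ xorSum-xor (allWords N) (xChild (actV (suc N) g v)) (xChild v) ⟨
  levelSum N (xChild (actV (suc N) g v)) xor levelSum N (xChild v)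
    ≡⟨ cong (_xor levelSum N (xChild v)) (levelSum-xChild-actV N g v) ⟩
  levelSum N (λ w → v (flipAt g w ∷ w)) xor levelSum N (xChild v)
    ≡⟨ xorSum-xor (allWords N) (λ w → v (flipAt g w ∷ w)) (xChild v) ⟩
  levelSum N (λ w → v (flipAt g w ∷ w) xor xChild v w)
    ≡⟨ levelSum-cong N _ _ (λ w ∣w∣ → trans (flip-difference (λ d → v (d ∷ w)) (flipAt g w))
                                           (trans (cong (flipAt g w ∧_) (children-differ w ∣w∣)) (∧-identityʳ _))) ⟩
  levelSum N (flipAt g)
    ≡⟨ levelSum-flipAt N g ⟩
  phi N g ∎
  where
  open ≡-Reasoning
  flip-difference : ∀ (f : Bool → Bool) t → f t xor f false ≡ t ∧ (f false xor f true)
  flip-difference f false = xor-same (f false)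
  flip-difference f true  = xor-comm (f true) (f false)

-- The composition series

isZero : ℕ → Vector → Bool
isZero zero    v = not (v [])
isZero (suc N) v = isZero N (xChild v) ∧ isZero N (yChild v)

isZero-sound : ∀ N v → isZero N v ≡ true → v ≈[ N ] zeroV
isZero-sound zero    v e [] refl with v []
isZero-sound zero    v () [] refl | true
...                                | false = refl
isZero-sound (suc N) v e (false ∷ u) refl = isZero-sound N (xChild v) (∧-true-left _ _ e) u refl
isZero-sound (suc N) v e (true ∷ u)  refl = isZero-sound N (yChild v) (∧-true-right _ _ e) u refl

isZero-complete : ∀ N v → v ≈[ N ] zeroV → isZero N v ≡ true
isZero-complete zero    v v≈0 rewrite v≈0 [] refl = refl
isZero-complete (suc N) v v≈0
  rewrite isZero-complete N (xChild v) (λ u ∣u∣ → v≈0 (false ∷ u) (cong suc ∣u∣))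
        | isZero-complete N (yChild v) (λ u ∣u∣ → v≈0 (true ∷ u) (cong suc ∣u∣)) = refl

isZero-cong : ∀ N v v' → v ≈[ N ] v' → isZero N v ≡ isZero N v'
isZero-cong zero    v v' v≈v' = cong not (v≈v' [] refl)
isZero-cong (suc N) v v' v≈v' =
  cong₂ _∧_ (isZero-cong N _ _ (λ u ∣u∣ → v≈v' (false ∷ u) (cong suc ∣u∣)))
            (isZero-cong N _ _ (λ u ∣u∣ → v≈v' (true ∷ u) (cong suc ∣u∣)))

isZero-⊕ : ∀ N v v' → isZero N v ≡ true → isZero N v' ≡ true → isZero N (v ⊕ v') ≡ true
isZero-⊕ N v v' v≈0 v'≈0 =
  isZero-complete N _ (λ u ∣u∣ → cong₂ _xor_ (isZero-sound N v v≈0 u ∣u∣) (isZero-sound N v' v'≈0 u ∣u∣))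

isZero-onesV : ∀ N → isZero N onesV ≡ false
isZero-onesV zero = refl
isZero-onesV (suc N) rewrite isZero-onesV N = refl

sumChildren-cong : ∀ N v v' → v ≈[ suc N ] v' → sumChildren v ≈[ N ] sumChildren v'
sumChildren-cong N v v' v≈v' u ∣u∣ = cong₂ _xor_ (v≈v' (false ∷ u) (cong suc ∣u∣)) (v≈v' (true ∷ u) (cong suc ∣u∣))

xChild-cong : ∀ N v v' → v ≈[ suc N ] v' → xChild v ≈[ N ] xChild v'
xChild-cong N v v' v≈v' u ∣u∣ = v≈v' (false ∷ u) (cong suc ∣u∣)

sumChildren-⊕ : ∀ N v v' → sumChildren (v ⊕ v') ≈[ N ] (sumChildren v ⊕ sumChildren v')
sumChildren-⊕ N v v' u _ = interchange (v (false ∷ u)) (v' (false ∷ u)) (v (true ∷ u)) (v' (true ∷ u))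

-- inW N k v decides v ∈ W^N_k.  For k ≤ 2^N, W^{N+1}_k is the preimage of W^N_k
-- under sumChildren; W^{N+1}_{2^N + r} consists of the v ∈ ker sumChildren with
-- xChild v ∈ W^N_r.  For k ≥ 2^N, W^N_k = 0.
inW : ℕ → ℕ → Vector → Bool
inW zero    zero    v = true
inW zero    (suc _) v = not (v [])
inW (suc N) k       v = if k <ᵇ 2 ^ N then inW N k (sumChildren v)
                        else isZero N (sumChildren v) ∧ inW N (k ∸ 2 ^ N) (xChild v)

data Position (p k : ℕ) : Set where
  below : k < p → Position p k
  above : ∀ r → k ≡ p + r → Position p k

position : ∀ p k → Position p k
position p k with p ≤? k
... | yes p≤k = above (k ∸ p) (sym (m+[n∸m]≡n p≤k))
... | no  p≰k = below (≰⇒> p≰k)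

2^-suc : ∀ N → 2 ^ suc N ≡ 2 ^ N + 2 ^ N
2^-suc N = cong (2 ^ N +_) (+-identityʳ (2 ^ N))

inW-below : ∀ N k v → k < 2 ^ N → inW (suc N) k v ≡ inW N k (sumChildren v)
inW-below N k v k< with k <ᵇ 2 ^ N in e
... | true  = refl
... | false = ⊥-elim (subst T e (<⇒<ᵇ k<))

inW-above : ∀ N r v → inW (suc N) (2 ^ N + r) v ≡ isZero N (sumChildren v) ∧ inW N r (xChild v)
inW-above N r v with (2 ^ N + r) <ᵇ 2 ^ N in e
... | false = cong (λ k → isZero N (sumChildren v) ∧ inW N k (xChild v)) (m+n∸m≡n (2 ^ N) r)
... | true  = ⊥-elim (<⇒≱ (<ᵇ⇒< _ _ (subst T (sym e) _)) (m≤m+n (2 ^ N) r))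

inW-above⇒ : ∀ N r v → inW (suc N) (2 ^ N + r) v ≡ true → isZero N (sumChildren v) ≡ true × inW N r (xChild v) ≡ true
inW-above⇒ N r v v∈ = ∧-true-left _ _ v∈′ , ∧-true-right _ _ v∈′
  where
  v∈′ : isZero N (sumChildren v) ∧ inW N r (xChild v) ≡ true
  v∈′ = trans (sym (inW-above N r v)) v∈

inW-0 : ∀ N v → inW N 0 v ≡ true
inW-0 zero    v = refl
inW-0 (suc N) v = trans (inW-below N 0 v (m^n>0 2 N)) (inW-0 N (sumChildren v))

inW-2^N : ∀ N v → inW N (2 ^ N) v ≡ isZero N v
inW-2^N zero    v = refl
inW-2^N (suc N) v = begin
  inW (suc N) (2 ^ suc N) v                                   ≡⟨ cong (λ k → inW (suc N) k v) (2^-suc N) ⟩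
  inW (suc N) (2 ^ N + 2 ^ N) v                               ≡⟨ inW-above N (2 ^ N) v ⟩
  isZero N (sumChildren v) ∧ inW N (2 ^ N) (xChild v)         ≡⟨ cong (isZero N (sumChildren v) ∧_) (inW-2^N N (xChild v)) ⟩
  isZero N (sumChildren v) ∧ isZero N (xChild v)              ≡⟨ kernel-split (isZero N (xChild v)) refl ⟩
  isZero N (xChild v) ∧ isZero N (yChild v)                   ∎
  where
  open ≡-Reasoning
  kernel-split : ∀ b → isZero N (xChild v) ≡ b →
                 isZero N (sumChildren v) ∧ b ≡ b ∧ isZero N (yChild v)
  kernel-split false _  = ∧-zeroʳ _
  kernel-split true  x≈0 =
    trans (∧-identityʳ _) (isZero-cong N _ _ (λ u ∣u∣ → cong (_xor v (true ∷ u)) (isZero-sound N _ x≈0 u ∣u∣)))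

inW-suc-≤ : ∀ N k v → k ≤ 2 ^ N → inW (suc N) k v ≡ inW N k (sumChildren v)
inW-suc-≤ N k v k≤ with position (2 ^ N) k
... | below k<       = inW-below N k v k<
... | above zero e   = begin
  inW (suc N) k v                                             ≡⟨ cong (λ k → inW (suc N) k v) e ⟩
  inW (suc N) (2 ^ N + 0) v                                   ≡⟨ inW-above N 0 v ⟩
  isZero N (sumChildren v) ∧ inW N 0 (xChild v)               ≡⟨ cong (isZero N (sumChildren v) ∧_) (inW-0 N (xChild v)) ⟩
  isZero N (sumChildren v) ∧ true                             ≡⟨ ∧-identityʳ _ ⟩
  isZero N (sumChildren v)                                    ≡⟨ inW-2^N N (sumChildren v) ⟨
  inW N (2 ^ N) (sumChildren v)                               ≡⟨ cong (λ k → inW N k (sumChildren v)) (trans (sym (+-identityʳ (2 ^ N))) (sym e)) ⟩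
  inW N k (sumChildren v)                                     ∎
  where open ≡-Reasoning
... | above (suc r) e = ⊥-elim (m+1+n≰m (2 ^ N) (subst (_≤ 2 ^ N) e k≤))

inW-cong : ∀ N k v v' → v ≈[ N ] v' → inW N k v ≡ inW N k v'
inW-cong zero    zero    v v' v≈v' = refl
inW-cong zero    (suc k) v v' v≈v' = cong not (v≈v' [] refl)
inW-cong (suc N) k       v v' v≈v' with position (2 ^ N) k
... | below k<     = begin
  inW (suc N) k v                ≡⟨ inW-below N k v k< ⟩
  inW N k (sumChildren v)        ≡⟨ inW-cong N k _ _ (sumChildren-cong N v v' v≈v') ⟩
  inW N k (sumChildren v')       ≡⟨ inW-below N k v' k< ⟨
  inW (suc N) k v'               ∎
  where open ≡-Reasoning
... | above r refl = begin
  inW (suc N) (2 ^ N + r) v                                ≡⟨ inW-above N r v ⟩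
  isZero N (sumChildren v) ∧ inW N r (xChild v)            ≡⟨ cong₂ _∧_ (isZero-cong N _ _ (sumChildren-cong N v v' v≈v'))
                                                                        (inW-cong N r _ _ (xChild-cong N v v' v≈v')) ⟩
  isZero N (sumChildren v') ∧ inW N r (xChild v')          ≡⟨ inW-above N r v' ⟨
  inW (suc N) (2 ^ N + r) v'                               ∎
  where open ≡-Reasoning

inW-⊕ : ∀ N k v v' → inW N k v ≡ true → inW N k v' ≡ true → inW N k (v ⊕ v') ≡ true
inW-⊕ zero    zero    v v' _ _ = refl
inW-⊕ zero    (suc k) v v' v∈ v'∈ with v [] | v' []
inW-⊕ zero    (suc k) v v' () v'∈ | true  | _
...                               | false | false = refl
inW-⊕ (suc N) k       v v' v∈ v'∈ with position (2 ^ N) k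
... | below k<     =
  trans (inW-below N k (v ⊕ v') k<)
        (trans (inW-cong N k _ _ (sumChildren-⊕ N v v'))
               (inW-⊕ N k (sumChildren v) (sumChildren v') (trans (sym (inW-below N k v k<)) v∈)
                                                            (trans (sym (inW-below N k v' k<)) v'∈)))
... | above r refl with inW-above⇒ N r v v∈ | inW-above⇒ N r v' v'∈
...   | v-agree , xv∈ | v'-agree , xv'∈ =
  trans (inW-above N r (v ⊕ v'))
        (cong₂ _∧_ (trans (isZero-cong N _ _ (sumChildren-⊕ N v v')) (isZero-⊕ N _ _ v-agree v'-agree))
                   (inW-⊕ N r _ _ xv∈ xv'∈))

inW-zeroV : ∀ N k → inW N k zeroV ≡ true
inW-zeroV zero    zero    = refl
inW-zeroV zero    (suc k) = refl
inW-zeroV (suc N) k with position (2 ^ N) k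
... | below k<     = trans (inW-below N k zeroV k<) (inW-zeroV N k)
... | above r refl = trans (inW-above N r zeroV)
                           (cong₂ _∧_ (isZero-complete N _ (λ _ _ → refl)) (inW-zeroV N r))

inW-beyond : ∀ N r v → inW N (2 ^ N + r) v ≡ true → v ≈[ N ] zeroV
inW-beyond zero    r v v∈ [] refl with v []
inW-beyond zero    r v () [] refl | true
...                               | false = refl
inW-beyond (suc N) r v v∈
  with inW-above⇒ N (2 ^ N + r) v (subst (λ k → inW (suc N) k v ≡ true)
                                         (trans (cong (_+ r) (2^-suc N)) (+-assoc (2 ^ N) (2 ^ N) r)) v∈)
... | v-agree , xv∈ = λ where
    (false ∷ u) ∣u∣ → x≈0 u (cong pred ∣u∣)
    (true ∷ u)  ∣u∣ → trans (cong (_xor v (true ∷ u)) (sym (x≈0 u (cong pred ∣u∣))))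
                            (isZero-sound N (sumChildren v) v-agree u (cong pred ∣u∣))
  where
  x≈0 : xChild v ≈[ N ] zeroV
  x≈0 = inW-beyond N r (xChild v) xv∈

inW-1 : ∀ N v → inW N 1 v ≡ not (levelSum N v)
inW-1 zero    v = cong not (sym (xor-identityʳ (v [])))
inW-1 (suc N) v = begin
  inW (suc N) 1 v                                  ≡⟨ inW-suc-≤ N 1 v (m^n>0 2 N) ⟩
  inW N 1 (sumChildren v)                          ≡⟨ inW-1 N (sumChildren v) ⟩
  not (levelSum N (sumChildren v))                 ≡⟨ cong not (xorSum-xor (allWords N) (xChild v) (yChild v)) ⟨
  not (levelSum N (xChild v) xor levelSum N (yChild v)) ≡⟨ cong not (levelSum-suc N v) ⟨
  not (levelSum (suc N) v)                         ∎
  where open ≡-Reasoning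

sumChildren-actMinusOne : ∀ N g v → sumChildren (actMinusOne (suc N) g v) ≈[ N ] actMinusOne N g (sumChildren v)
sumChildren-actMinusOne N g v u ∣u∣ =
  trans (sumChildren-⊕ N (actV (suc N) g v) v u ∣u∣) (cong (_xor sumChildren v u) (sumChildren-actV N g v u))

xChild-actMinusOne : ∀ N g v → sumChildren v ≈[ N ] zeroV →
                     xChild (actMinusOne (suc N) g v) ≈[ N ] actMinusOne N g (xChild v)
xChild-actMinusOne N g v children-agree u _ = cong (_xor v (false ∷ u)) (actV-xChild N g v false u children-agree)

actMinusOne-≈zero : ∀ N g v → v ≈[ N ] zeroV → actMinusOne N g v ≈[ N ] zeroV
actMinusOne-≈zero N g v v≈0 u ∣u∣ = cong₂ _xor_ (trans (actV-cong N g v zeroV v≈0 u) (actV-zeroV N g u)) (v≈0 u ∣u∣)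

inW-actMinusOne : ∀ N k g v → inW N k v ≡ true → inW N (suc k) (actMinusOne N g v) ≡ true
inW-actMinusOne zero    k g v _ rewrite actV-[] g v | xor-same (v []) = refl
inW-actMinusOne (suc N) k g v v∈ with position (2 ^ N) k
... | below k<     =
  trans (inW-suc-≤ N (suc k) (actMinusOne (suc N) g v) k<)
        (trans (inW-cong N (suc k) _ _ (sumChildren-actMinusOne N g v))
               (inW-actMinusOne N k g (sumChildren v) (trans (sym (inW-below N k v k<)) v∈)))
... | above r refl with inW-above⇒ N r v v∈
...   | v-agree , xv∈ =
  trans (cong (λ k → inW (suc N) k (actMinusOne (suc N) g v)) (sym (+-suc (2 ^ N) r)))
        (trans (inW-above N (suc r) (actMinusOne (suc N) g v))
               (cong₂ _∧_ (isZero-complete N _ (λ u ∣u∣ → trans (sumChildren-actMinusOne N g v u ∣u∣)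
                                                                (actMinusOne-≈zero N g (sumChildren v) children-agree u ∣u∣)))
                          (trans (inW-cong N (suc r) _ _ (xChild-actMinusOne N g v children-agree))
                                 (inW-actMinusOne N r g (xChild v) xv∈))))
  where
  children-agree : sumChildren v ≈[ N ] zeroV
  children-agree = isZero-sound N (sumChildren v) v-agree

InLayer : ℕ → ℕ → Vector → Set
InLayer N k v = inW N k v ≡ true × inW N (suc k) v ≡ false

inLayer-cong : ∀ N k v v' → v ≈[ N ] v' → InLayer N k v' → InLayer N k v
inLayer-cong N k v v' v≈v' (v'∈ , v'∉) = trans (inW-cong N k v v' v≈v') v'∈ , trans (inW-cong N (suc k) v v' v≈v') v'∉

inLayer-sumChildren : ∀ N k v → k < 2 ^ N → InLayer (suc N) k v → InLayer N k (sumChildren v)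
inLayer-sumChildren N k v k< (v∈ , v∉) = trans (sym (inW-below N k v k<)) v∈ , trans (sym (inW-suc-≤ N (suc k) v k<)) v∉

inLayer-xChild : ∀ N r v → InLayer (suc N) (2 ^ N + r) v → isZero N (sumChildren v) ≡ true × InLayer N r (xChild v)
inLayer-xChild N r v (v∈ , v∉) with inW-above⇒ N r v v∈
... | v-agree , xv∈ = v-agree , xv∈ , subst (λ a → a ∧ inW N (suc r) (xChild v) ≡ false) v-agree v∉′
  where
  v∉′ : isZero N (sumChildren v) ∧ inW N (suc r) (xChild v) ≡ false
  v∉′ = trans (sym (inW-above N (suc r) v)) (trans (cong (λ k → inW (suc N) k v) (+-suc (2 ^ N) r)) v∉)

layer-oneDimensional : ∀ N k v v' → InLayer N k v → InLayer N k v' → k < 2 ^ N → inW N (suc k) (v ⊕ v') ≡ true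
layer-oneDimensional zero zero v v' (_ , v∉) (_ , v'∉) _ with v [] | v' []
... | true  | true  = refl
layer-oneDimensional zero (suc k) v v' _ _ (s≤s ())
layer-oneDimensional (suc N) k v v' v∈ v'∈ k< with position (2 ^ N) k
... | below k<′    =
  trans (inW-suc-≤ N (suc k) (v ⊕ v') k<′)
        (trans (inW-cong N (suc k) _ _ (sumChildren-⊕ N v v'))
               (layer-oneDimensional N k _ _ (inLayer-sumChildren N k v k<′ v∈) (inLayer-sumChildren N k v' k<′ v'∈) k<′))
... | above r refl with inLayer-xChild N r v v∈ | inLayer-xChild N r v' v'∈
...   | v-agree , xv∈ | v'-agree , xv'∈ =
  trans (cong (λ k → inW (suc N) k (v ⊕ v')) (sym (+-suc (2 ^ N) r)))
        (trans (inW-above N (suc r) (v ⊕ v'))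
               (cong₂ _∧_ (trans (isZero-cong N _ _ (sumChildren-⊕ N v v')) (isZero-⊕ N _ _ v-agree v'-agree))
                          (layer-oneDimensional N r _ _ xv∈ xv'∈ r<)))
  where
  r< : r < 2 ^ N
  r< = +-cancelˡ-< (2 ^ N) r (2 ^ N) (subst (2 ^ N + r <_) (2^-suc N) k<)

2^N≡suc-pred : ∀ N → 2 ^ N ≡ suc (pred (2 ^ N))
2^N≡suc-pred N = sym (suc-pred (2 ^ N) {{m^n≢0 2 N}})

inW-onesV : ∀ N m → 2 ^ N ≡ suc m → inW N m onesV ≡ true
inW-onesV zero    zero e = refl
inW-onesV (suc N) m    e = begin
  inW (suc N) m onesV                                           ≡⟨ cong (λ k → inW (suc N) k onesV) m≡ ⟩
  inW (suc N) (2 ^ N + pred (2 ^ N)) onesV                      ≡⟨ inW-above N (pred (2 ^ N)) onesV ⟩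
  isZero N (sumChildren onesV) ∧ inW N (pred (2 ^ N)) onesV     ≡⟨ cong₂ _∧_ (isZero-complete N _ (λ _ _ → refl))
                                                                             (inW-onesV N (pred (2 ^ N)) (2^N≡suc-pred N)) ⟩
  true                                                          ∎
  where
  open ≡-Reasoning
  m≡ : m ≡ 2 ^ N + pred (2 ^ N)
  m≡ = suc-injective (begin
    suc m                        ≡⟨ e ⟨
    2 ^ suc N                    ≡⟨ 2^-suc N ⟩
    2 ^ N + 2 ^ N                ≡⟨ cong (2 ^ N +_) (2^N≡suc-pred N) ⟩
    2 ^ N + suc (pred (2 ^ N))   ≡⟨ +-suc (2 ^ N) (pred (2 ^ N)) ⟩
    suc (2 ^ N + pred (2 ^ N))   ∎)

topLayer≈onesV : ∀ N m v → 2 ^ N ≡ suc m → InLayer N m v → v ≈[ N ] onesV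
topLayer≈onesV N m v e v∈ u ∣u∣ = flipped (v u) (isZero-sound N (v ⊕ onesV) sum-vanishes u ∣u∣)
  where
  inW-suc-m : ∀ v → inW N (suc m) v ≡ isZero N v
  inW-suc-m v = trans (cong (λ k → inW N k v) (sym e)) (inW-2^N N v)
  onesV∈ : InLayer N m onesV
  onesV∈ = inW-onesV N m e , trans (inW-suc-m onesV) (isZero-onesV N)
  sum-vanishes : isZero N (v ⊕ onesV) ≡ true
  sum-vanishes = trans (sym (inW-suc-m (v ⊕ onesV)))
                       (layer-oneDimensional N m v onesV v∈ onesV∈ (subst (m <_) (sym e) ≤-refl))
  flipped : ∀ b → (b xor true) ≡ false → b ≡ true
  flipped true _ = refl

-- ν₂ N m is the 2-adic valuation of m, for 0 < m < 2 ^ N.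
ν₂ : ℕ → ℕ → ℕ
ν₂ zero    m = 0
ν₂ (suc N) m = if m <ᵇ 2 ^ N then ν₂ N m else (if m ≡ᵇ 2 ^ N then N else ν₂ N (m ∸ 2 ^ N))

ν₂-below : ∀ N m → m < 2 ^ N → ν₂ (suc N) m ≡ ν₂ N m
ν₂-below N m m< with m <ᵇ 2 ^ N in e
... | true  = refl
... | false = ⊥-elim (subst T e (<⇒<ᵇ m<))

ν₂-2^N : ∀ N → ν₂ (suc N) (2 ^ N) ≡ N
ν₂-2^N N with 2 ^ N <ᵇ 2 ^ N in e₁
... | true  = ⊥-elim (<-irrefl refl (<ᵇ⇒< (2 ^ N) (2 ^ N) (subst T (sym e₁) _)))
... | false with 2 ^ N ≡ᵇ 2 ^ N in e₂
...   | true  = refl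
...   | false = ⊥-elim (subst T e₂ (≡⇒≡ᵇ (2 ^ N) (2 ^ N) refl))

ν₂-above : ∀ N r → ν₂ (suc N) (2 ^ N + suc r) ≡ ν₂ N (suc r)
ν₂-above N r with (2 ^ N + suc r) <ᵇ 2 ^ N in e₁
... | true  = ⊥-elim (<⇒≱ (<ᵇ⇒< _ _ (subst T (sym e₁) _)) (m≤m+n (2 ^ N) (suc r)))
... | false with (2 ^ N + suc r) ≡ᵇ 2 ^ N in e₂
...   | true  = ⊥-elim (m+1+n≢m (2 ^ N) (≡ᵇ⇒≡ _ _ (subst T (sym e₂) _)))
...   | false = cong (ν₂ N) (m+n∸m≡n (2 ^ N) (suc r))

actMinusOne-∉-midpoint : ∀ N k g v → suc k ≡ 2 ^ N → InLayer (suc N) k v → phi N g ≡ true →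
                         inW (suc N) (suc (suc k)) (actMinusOne (suc N) g v) ≡ false
actMinusOne-∉-midpoint N k g v k+1≡ v∈ φN≡true = begin
  inW (suc N) (suc (suc k)) (actMinusOne (suc N) g v)
    ≡⟨ cong (λ m → inW (suc N) m (actMinusOne (suc N) g v)) (trans (cong suc k+1≡) (+-comm 1 (2 ^ N))) ⟩
  inW (suc N) (2 ^ N + 1) (actMinusOne (suc N) g v)
    ≡⟨ inW-above N 1 (actMinusOne (suc N) g v) ⟩
  isZero N (sumChildren (actMinusOne (suc N) g v)) ∧ inW N 1 (xChild (actMinusOne (suc N) g v))
    ≡⟨ cong (isZero N (sumChildren (actMinusOne (suc N) g v)) ∧_) (inW-1 N (xChild (actMinusOne (suc N) g v))) ⟩
  isZero N (sumChildren (actMinusOne (suc N) g v)) ∧ not (levelSum N (xChild (actMinusOne (suc N) g v)))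
    ≡⟨ cong (λ b → isZero N (sumChildren (actMinusOne (suc N) g v)) ∧ not b)
            (trans (levelSum-xChild-actMinusOne N g v children-differ) φN≡true) ⟩
  isZero N (sumChildren (actMinusOne (suc N) g v)) ∧ false
    ≡⟨ ∧-zeroʳ _ ⟩
  false ∎
  where
  open ≡-Reasoning
  children-differ : sumChildren v ≈[ N ] onesV
  children-differ = topLayer≈onesV N k (sumChildren v) (sym k+1≡) (inLayer-sumChildren N k v (subst (k <_) k+1≡ ≤-refl) v∈)

actMinusOne-∉ : ∀ N k g v → InLayer N k v → suc k < 2 ^ N → phi (ν₂ N (suc k)) g ≡ true →
                inW N (suc (suc k)) (actMinusOne N g v) ≡ false
actMinusOne-∉ zero    k g v v∈ (s≤s ()) φ≡true
actMinusOne-∉ (suc N) k g v v∈ k+1< φ≡true with position (2 ^ N) (suc k)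
... | below k+1<′ =
  trans (inW-suc-≤ N (suc (suc k)) (actMinusOne (suc N) g v) k+1<′)
        (trans (inW-cong N (suc (suc k)) _ _ (sumChildren-actMinusOne N g v))
               (actMinusOne-∉ N k g (sumChildren v) (inLayer-sumChildren N k v (≤-trans (n≤1+n (suc k)) k+1<′) v∈)
                              k+1<′ (trans (cong (λ m → phi m g) (sym (ν₂-below N (suc k) k+1<′))) φ≡true)))
... | above zero e =
  actMinusOne-∉-midpoint N k g v k+1≡ v∈ (trans (cong (λ m → phi m g) (sym (trans (cong (ν₂ (suc N)) k+1≡) (ν₂-2^N N)))) φ≡true)
  where
  k+1≡ : suc k ≡ 2 ^ N
  k+1≡ = trans e (+-identityʳ _)
... | above (suc r) e with inLayer-xChild N r v (subst (λ k → InLayer (suc N) k v) (suc-injective (trans e (+-suc (2 ^ N) r))) v∈)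
...   | v-agree , xv∈ =
  trans (cong (λ m → inW (suc N) m (actMinusOne (suc N) g v)) (trans (cong suc e) (sym (+-suc (2 ^ N) (suc r)))))
        (trans (inW-above N (suc (suc r)) (actMinusOne (suc N) g v))
               (trans (cong (isZero N (sumChildren (actMinusOne (suc N) g v)) ∧_)
                            (trans (inW-cong N (suc (suc r)) _ _ (xChild-actMinusOne N g v (isZero-sound N (sumChildren v) v-agree)))
                                   (actMinusOne-∉ N r g (xChild v) xv∈ r+1< φr≡true)))
                      (∧-zeroʳ _)))
  where
  r+1< : suc r < 2 ^ N
  r+1< = +-cancelˡ-< (2 ^ N) (suc r) (2 ^ N) (subst (_< 2 ^ N + 2 ^ N) e (subst (suc k <_) (2^-suc N) k+1<))
  φr≡true : phi (ν₂ N (suc r)) g ≡ true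
  φr≡true = trans (cong (λ m → phi m g) (sym (trans (cong (ν₂ (suc N)) e) (ν₂-above N r)))) φ≡true

inLayer-actMinusOne : ∀ N k g v → InLayer N k v → suc k < 2 ^ N → phi (ν₂ N (suc k)) g ≡ true →
                      InLayer N (suc k) (actMinusOne N g v)
inLayer-actMinusOne N k g v v∈ k+1< φ≡true = inW-actMinusOne N k g v (proj₁ v∈) , actMinusOne-∉ N k g v v∈ k+1< φ≡true

-- Products of augmentation elements

inW-actR : ∀ N k a u → augmentation a ≡ false → inW N k u ≡ true → inW N (suc k) (actR N a u) ≡ true
inW-actR N k []          u _ _  = inW-zeroV N (suc k)
inW-actR N k (g ∷ h ∷ a) u ε≡0 u∈ =
  trans (inW-cong N (suc k) _ (actMinusOne N g u ⊕ (actMinusOne N h u ⊕ actR N a u)) pair-up)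
        (inW-⊕ N (suc k) _ _ (inW-actMinusOne N k g u u∈)
                             (inW-⊕ N (suc k) _ _ (inW-actMinusOne N k h u u∈)
                                                  (inW-actR N k a u (trans (sym (not-involutive _)) ε≡0) u∈)))
  where
  pair-up : actR N (g ∷ h ∷ a) u ≈[ N ] (actMinusOne N g u ⊕ (actMinusOne N h u ⊕ actR N a u))
  pair-up w _ = begin
    actV N g u w xor (actV N h u w xor actR N a u w)             ≡⟨ xor-cancel-middle (actV N g u w) (u w) _ ⟨
    (actV N g u w xor u w) xor (u w xor (actV N h u w xor actR N a u w))
      ≡⟨ cong ((actV N g u w xor u w) xor_) (trans (sym (xor-assoc (u w) _ _))
                                                   (cong (_xor actR N a u w) (xor-comm (u w) (actV N h u w)))) ⟩
    (actV N g u w xor u w) xor ((actV N h u w xor u w) xor actR N a u w) ∎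
    where open ≡-Reasoning

inW-actProd : ∀ N as m → All (λ a → augmentation a ≡ false) as → inW N (length as) (actProd N as m) ≡ true
inW-actProd N []       m []         = inW-0 N m
inW-actProd N (a ∷ as) m (ε≡0 ∷ ps) = inW-actR N (length as) a _ ε≡0 (inW-actProd N as m ps)

InPowerSubmodule⇒inW : ∀ G i N v → InPowerSubmodule G i N v → inW N i v ≡ true
InPowerSubmodule⇒inW G i N v (gens , ps , v≈) = trans (inW-cong N i v _ v≈) (sum∈ gens ps)
  where
  sum∈ : ∀ gens → All (λ p → length (proj₁ p) ≡ i × All (InAugIdeal G) (proj₁ p)) gens →
         inW N i (sumV (map (λ p → actProd N (proj₁ p) (proj₂ p)) gens)) ≡ true
  sum∈ []               []                  = inW-zeroV N i
  sum∈ ((as , m) ∷ gens) ((refl , as∈) ∷ ps) =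
    inW-⊕ N i _ _ (inW-actProd N as m (All.map proj₂ as∈)) (sum∈ gens ps)

-- Spanning the composition series

module _ (G : Portrait → Set) (i N : ℕ) where

  inPower-≈zero : ∀ v → v ≈[ N ] zeroV → InPowerSubmodule G i N v
  inPower-≈zero v v≈0 = [] , [] , v≈0

  inPower-⊕ : ∀ v v' → InPowerSubmodule G i N v → InPowerSubmodule G i N v' → InPowerSubmodule G i N (v ⊕ v')
  inPower-⊕ v v' (gens , ps , v≈) (gens' , ps' , v'≈) =
    gens ++ gens' , All.++⁺ ps ps' , λ u ∣u∣ → trans (cong₂ _xor_ (v≈ u ∣u∣) (v'≈ u ∣u∣)) (sym (sum-++ u))
    where
    term : List GroupRingElt × Vector → Vector
    term p = actProd N (proj₁ p) (proj₂ p)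
    sum-++ : ∀ u → sumV (map term (gens ++ gens')) u ≡ sumV (map term gens) u xor sumV (map term gens') u
    sum-++ u rewrite map-++ term gens gens' = go (map term gens)
      where
      go : ∀ vs → sumV (vs ++ map term gens') u ≡ sumV vs u xor sumV (map term gens') u
      go []       = refl
      go (w ∷ vs) rewrite go vs = sym (xor-assoc (w u) (sumV vs u) _)

  inPower-cong : ∀ v v' → v ≈[ N ] v' → InPowerSubmodule G i N v' → InPowerSubmodule G i N v
  inPower-cong v v' v≈v' (gens , ps , v'≈) = gens , ps , λ u ∣u∣ → trans (v≈v' u ∣u∣) (v'≈ u ∣u∣)

inPower-mono : ∀ {G H : Portrait → Set} → (∀ g → G g → H g) → ∀ i N v →
               InPowerSubmodule G i N v → InPowerSubmodule H i N v
inPower-mono {G} {H} G⊆H i N v (gens , ps , v≈) = gens , All.map (λ (ℓ , as∈) → ℓ , All.map ideal-mono as∈) ps , v≈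
  where
  ideal-mono : ∀ {a} → InAugIdeal G a → InAugIdeal H a
  ideal-mono (a∈ , ε≡0) = All.map (G⊆H _) a∈ , ε≡0

module Spanning (G : Portrait → Set) (identity∈G : G identityPortrait)
                (witness : ∀ j → Σ Portrait (λ g → G g × phi j g ≡ true)) (N : ℕ) where

  g : ℕ → Portrait
  g k = proj₁ (witness (ν₂ N k))

  factors : ℕ → List GroupRingElt
  factors zero    = []
  factors (suc k) = (g (suc k) ∷ identityPortrait ∷ []) ∷ factors k

  length-factors : ∀ k → length (factors k) ≡ k
  length-factors zero    = refl
  length-factors (suc k) = cong suc (length-factors k)

  factors∈ : ∀ k → All (InAugIdeal G) (factors k)
  factors∈ zero    = []
  factors∈ (suc k) = (proj₁ (proj₂ (witness _)) ∷ identity∈G ∷ [] , refl) ∷ factors∈ k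

  xᴺ : Word
  xᴺ = replicate N false

  y : ℕ → Vector
  y k = actProd N (factors k) (basis xᴺ)

  y-suc : ∀ k → y (suc k) ≈[ N ] actMinusOne N (g (suc k)) (y k)
  y-suc k u ∣u∣ = cong (actV N (g (suc k)) (y k) u xor_) (trans (xor-identityʳ _) (actV-identity N (y k) u ∣u∣))

  y∈layer : ∀ k → k < 2 ^ N → InLayer N k (y k)
  y∈layer zero    _    = inW-0 N (y 0) , trans (inW-1 N (y 0)) (cong not (levelSum-== N xᴺ (length-replicate N)))
  y∈layer (suc k) k+1< =
    inLayer-cong N (suc k) _ _ (y-suc k)
                 (inLayer-actMinusOne N k (g (suc k)) (y k) (y∈layer k (≤-trans (n≤1+n (suc k)) k+1<)) k+1<
                                      (proj₂ (proj₂ (witness (ν₂ N (suc k))))))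

  y∈power : ∀ i k → i ≤ k → InPowerSubmodule G i N (y k)
  y∈power i k i≤k =
    (take i (factors k) , actProd N (drop i (factors k)) (basis xᴺ)) ∷ [] ,
    (length-take-≤ i (factors k) (subst (i ≤_) (sym (length-factors k)) i≤k) , All.take⁺ i (factors∈ k)) ∷ [] ,
    λ u _ → begin
      y k u
        ≡⟨ cong (λ fs → actProd N fs (basis xᴺ) u) (take++drop≡id i (factors k)) ⟨
      actProd N (take i (factors k) ++ drop i (factors k)) (basis xᴺ) u
        ≡⟨ cong (_$ u) (foldr-++ (actR N) (basis xᴺ) (take i (factors k)) (drop i (factors k))) ⟩
      actProd N (take i (factors k)) (actProd N (drop i (factors k)) (basis xᴺ)) u
        ≡⟨ xor-identityʳ _ ⟨
      actProd N (take i (factors k)) (actProd N (drop i (factors k)) (basis xᴺ)) u xor false ∎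
    where open ≡-Reasoning

  descend : ∀ i d k → k + d ≡ 2 ^ N → i ≤ k → ∀ v → inW N k v ≡ true → InPowerSubmodule G i N v
  descend i zero    k k≡ i≤k v v∈ =
    inPower-≈zero G i N v (inW-beyond N 0 v (subst (λ k → inW N k v ≡ true) k≡2^N+0 v∈))
    where
    k≡2^N+0 : k ≡ 2 ^ N + 0
    k≡2^N+0 = trans (sym (+-identityʳ k)) (trans k≡ (sym (+-identityʳ (2 ^ N))))
  descend i (suc d) k k+d≡ i≤k v v∈ with inW N (suc k) v in v∈′
  ... | true  = descend i d (suc k) (trans (sym (+-suc k d)) k+d≡) (≤-trans i≤k (n≤1+n k)) v v∈′
  ... | false =
    inPower-cong G i N v ((v ⊕ y k) ⊕ y k) (λ u _ → xor-cancel-twice (v u) (y k u))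
      (inPower-⊕ G i N (v ⊕ y k) (y k)
        (descend i d (suc k) (trans (sym (+-suc k d)) k+d≡) (≤-trans i≤k (n≤1+n k)) (v ⊕ y k)
                 (layer-oneDimensional N k v (y k) (v∈ , v∈′) (y∈layer k k<) k<))
        (y∈power i k i≤k))
    where
    k< : k < 2 ^ N
    k< = subst (k <_) k+d≡ (m<m+n k z<s)
    xor-cancel-twice : ∀ a b → a ≡ (a xor b) xor b
    xor-cancel-twice a b = sym (trans (xor-assoc a b b) (trans (cong (a xor_) (xor-same b)) (xor-identityʳ a)))

  inW⇒inPower : ∀ i v → inW N i v ≡ true → InPowerSubmodule G i N v
  inW⇒inPower i v v∈ with position (2 ^ N) i
  ... | below i<     = descend i (2 ^ N ∸ i) i (m+[n∸m]≡n (<⇒≤ i<)) ≤-refl v v∈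
  ... | above r refl = inPower-≈zero G i N v (inW-beyond N r v v∈)

proposition6p9 : (G : Portrait → Set) → ClosedSubgroup G →
    (∀ i → Σ Portrait (λ g → G g × phi i g ≡ true)) →
    ∀ i N (v : Vector) → InPowerSubmodule G i N v ⇔ InPowerSubmodule AllOmega i N v
proposition6p9 G G-closed witness i N v =
  mk⇔ (inPower-mono (λ _ _ → tt) i N v)
      (Spanning.inW⇒inPower G (ClosedSubgroup.one-mem G-closed) witness N i v ∘ InPowerSubmodule⇒inW AllOmega i N v)
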